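{- $\mathbb{N}\setminus B_2\subseteq\{\lfloor n/\phi\rfloor+n : n\ge1\}$.
   Context: $\mathbb{N}$ denotes the positive integers. $F_i$ are the Fibonacci numbers ($F_0=0,F_1=1,F_{m+1}=F_m+F_{m-1}$), $\phi=(1+\sqrt5)/2$. Chung–Graham representation: every nonnegative integer $n$ is uniquely $n=\sum_{j\ge1}c_jF_{2j}$ with $c_j\in\{0,1,2\}$ such that whenever $j<j'$ and $c_j=c_{j'}=2$ there is $j''$ with $j<j''<j'$ and $c_{j''}=0$. $B_2$ is the set of positive integers whose Chung–Graham representation has $c_1\neq0$. -}

module Defs where

open import Data.Nat using (ℕ; zero; suc; _+_; _*_; _≤_; _<_)
open import Data.List using (List; []; _∷_; length)
open import Data.List.Relation.Unary.All using (All)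
open import Data.Product using (Σ; _×_; ∃)
open import Relation.Binary.PropositionalEquality using (_≡_; _≢_)

fib : ℕ → ℕ
fib zero = 0
fib (suc zero) = 1
fib (suc (suc m)) = fib (suc m) + fib m

-- A finite digit sequence c = (c₁ , c₂ , … , c_k) given as a list [c₁, …, c_k];
-- digit c j = c_j (1-indexed), and c_j = 0 for j = 0 or j > k.
digit : List ℕ → ℕ → ℕ
digit [] _ = 0
digit (x ∷ xs) zero = 0
digit (x ∷ xs) (suc zero) = x
digit (x ∷ xs) (suc (suc j)) = digit xs (suc j)

cgValueFrom : ℕ → List ℕ → ℕ
cgValueFrom j [] = 0
cgValueFrom j (x ∷ xs) = x * fib (2 * j) + cgValueFrom (suc j) xs

cgValue : List ℕ → ℕ
cgValue = cgValueFrom 1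

CGAdmissible : List ℕ → Set
CGAdmissible c =
  All (_≤ 2) c ×
  (∀ j j' → 1 ≤ j → j < j' → digit c j ≡ 2 → digit c j' ≡ 2 →
     ∃ λ j'' → j < j'' × j'' < j' × digit c j'' ≡ 0)

CGRep : ℕ → List ℕ → Set
CGRep n c = CGAdmissible c × cgValue c ≡ n

B₂ : ℕ → Set
B₂ n = 1 ≤ n × Σ (List ℕ) (λ c → CGRep n c × digit c 1 ≢ 0)

-- FloorDivPhi n m  ⇔  m = ⌊ n / φ ⌋.
-- Since n/φ = n(√5 − 1)/2, the condition m ≤ n/φ < m + 1 is equivalent to
-- 2m + n ≤ n√5 < 2m + n + 2, i.e. (squaring nonnegative quantities)
-- (2m + n)² ≤ 5n² < (2m + n + 2)².
FloorDivPhi : ℕ → ℕ → Set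
FloorDivPhi n m =
  (2 * m + n) * (2 * m + n) ≤ 5 * (n * n) ×
  5 * (n * n) < (2 * m + n + 2) * (2 * m + n + 2)

-- A Chung–Graham representation of N is found greedily, the top digit being
-- ⌊N / F_{2k}⌋; a top digit 2 leaves a remainder below F_{2k−1}, whose own
-- representation has a 0 above its last 2, so admissibility is kept.
--
-- If N ∉ B₂ this representation has c₁ = 0, and F_{2j} = F_{2j−1} + F_{2j−2}
-- gives N = n + m with n = Σ c_j F_{2j−1} and m = Σ c_j F_{2j−2}. In terms of
-- Q(n, m) = n² − nm − m², m = ⌊n/φ⌋ means Q(n, m) ≥ 0 > Q(n, m + 1). Putting a
-- new lowest digit c ∈ {0, 1, 2} under the others maps (n, m) to
-- (n′, m′) = (2c + 2n + m, c + n + m) with Q(n′, m′) = Q(n, m) + c(c + 2n − m),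
-- and together with the bounds m ≤ n ≤ 2m + 1 this keeps m = ⌊n/φ⌋.

{-# OPTIONS --safe #-}
module Submission where

open import Defs
open import Data.Empty using (⊥-elim)
open import Data.List using (List; []; _∷_; _∷ʳ_; length)
open import Data.List.Properties using (length-++)
open import Data.List.Relation.Unary.All using (All; []; _∷_)
open import Data.Nat
open import Data.Nat.Properties
open import Data.Nat.Tactic.RingSolver using (solve-∀)
open import Data.Product using (∃; _×_; _,_)
open import Relation.Nullary using (¬_; yes; no)
open import Relation.Binary.PropositionalEquality
  using (_≡_; refl; sym; trans; cong; cong₂; subst; subst₂; module ≡-Reasoning)

fibEven fibOdd : ℕ → ℕ
fibEven k = fib (2 * k)
fibOdd  k = fib (suc (2 * k))

fibEven-suc : ∀ k → fibEven (suc k) ≡ fibOdd k + fibEven k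
fibEven-suc k = cong fib (*-suc 2 k)

fibOdd-suc : ∀ k → fibOdd (suc k) ≡ fibEven (suc k) + fibOdd k
fibOdd-suc k = begin
  fib (suc (2 * suc k))                   ≡⟨ cong (λ i → fib (suc i)) (*-suc 2 k) ⟩
  fib (suc (suc (2 * k))) + fibOdd k      ≡⟨ cong (_+ fibOdd k) (fibEven-suc k) ⟨
  fibEven (suc k) + fibOdd k              ∎
  where open ≡-Reasoning

fibOdd≤fibEven-suc : ∀ k → fibOdd k ≤ fibEven (suc k)
fibOdd≤fibEven-suc k = subst (fibOdd k ≤_) (sym (fibEven-suc k)) (m≤m+n _ _)

1≤fib-suc : ∀ n → 1 ≤ fib (suc n)
1≤fib-suc zero    = ≤-refl
1≤fib-suc (suc n) = ≤-trans (1≤fib-suc n) (m≤m+n _ _)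

n<fibEven-suc : ∀ n → n < fibEven (suc n)
n<fibEven-suc zero    = ≤-refl
n<fibEven-suc (suc n) = subst (suc n <_) (sym (fibEven-suc (suc n)))
  (+-mono-≤ (1≤fib-suc (2 * suc n)) (n<fibEven-suc n))

-- Reading c₁, c₂, … upwards, the state is pending from a 2 until the next 0,
-- so admissibility means that no 2 is read while pending.
data Mode : Set where
  free pending : Mode

data Step : Mode → ℕ → Mode → Set where
  read0 : ∀ {p} → Step p 0 free
  read1 : ∀ {p} → Step p 1 p
  read2 : Step free 2 pending

data Scan : Mode → List ℕ → Mode → Set where
  []  : ∀ {p} → Scan p [] p
  _∷_ : ∀ {p d q ds r} → Step p d q → Scan q ds r → Scan p (d ∷ ds) r

step-≤2 : ∀ {p d q} → Step p d q → d ≤ 2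
step-≤2 read0 = z≤n
step-≤2 read1 = s≤s z≤n
step-≤2 read2 = ≤-refl

scan-≤2 : ∀ {p ds q} → Scan p ds q → All (_≤ 2) ds
scan-≤2 []        = []
scan-≤2 (st ∷ sc) = step-≤2 st ∷ scan-≤2 sc

scan-∷ʳ : ∀ {p ds q d r} → Scan p ds q → Step q d r → Scan p (ds ∷ʳ d) r
scan-∷ʳ []         st = st ∷ []
scan-∷ʳ (st′ ∷ sc) st = st′ ∷ scan-∷ʳ sc st

pending-zero-before-two : ∀ {ds q} → Scan pending ds q → ∀ j → digit ds j ≡ 2 →
  ∃ λ j″ → 1 ≤ j″ × j″ < j × digit ds j″ ≡ 0
pending-zero-before-two (read0 ∷ sc) (suc (suc j)) _ = 1 , ≤-refl , s≤s (s≤s z≤n) , refl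
pending-zero-before-two (read1 ∷ sc) (suc (suc j)) eq
  with pending-zero-before-two sc (suc j) eq
... | j″ , s≤s z≤n , j″<j , eq″ = suc j″ , s≤s z≤n , s≤s j″<j , eq″

scan-zero-between-twos : ∀ {p ds q} → Scan p ds q →
  ∀ j j′ → 1 ≤ j → j < j′ → digit ds j ≡ 2 → digit ds j′ ≡ 2 →
  ∃ λ j″ → j < j″ × j″ < j′ × digit ds j″ ≡ 0
scan-zero-between-twos (read2 ∷ sc) 1 (suc j′) _ (s≤s (s≤s _)) _ eq′
  with pending-zero-before-two sc j′ eq′
... | j″ , 1≤j″@(s≤s z≤n) , j″<j′ , eq″ = suc j″ , s≤s 1≤j″ , s≤s j″<j′ , eq″
scan-zero-between-twos (_ ∷ sc) (suc (suc j)) (suc (suc j′)) _ (s≤s j<j′) eq eq′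
  with scan-zero-between-twos sc (suc j) (suc j′) (s≤s z≤n) j<j′ eq eq′
... | j″ , j<j″@(s≤s _) , j″<j′ , eq″ = suc j″ , s≤s j<j″ , s≤s j″<j′ , eq″

cgValueFrom-∷ʳ : ∀ j ds d →
  cgValueFrom j (ds ∷ʳ d) ≡ cgValueFrom j ds + d * fibEven (j + length ds)
cgValueFrom-∷ʳ j [] d =
  trans (+-identityʳ _) (cong (λ i → d * fibEven i) (sym (+-identityʳ j)))
cgValueFrom-∷ʳ j (x ∷ xs) d = begin
  x * fibEven j + cgValueFrom (suc j) (xs ∷ʳ d)
    ≡⟨ cong (x * fibEven j +_) (cgValueFrom-∷ʳ (suc j) xs d) ⟩
  x * fibEven j + (cgValueFrom (suc j) xs + d * fibEven (suc j + length xs))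
    ≡⟨ +-assoc (x * fibEven j) _ _ ⟨
  x * fibEven j + cgValueFrom (suc j) xs + d * fibEven (suc j + length xs)
    ≡⟨ cong (λ i → x * fibEven j + cgValueFrom (suc j) xs + d * fibEven i) (+-suc j (length xs)) ⟨
  x * fibEven j + cgValueFrom (suc j) xs + d * fibEven (j + suc (length xs))
    ∎
  where open ≡-Reasoning

record GreedyDigits (k N : ℕ) : Set where
  field
    {final} : Mode
    digits  : List ℕ
    length≡ : length digits ≡ k
    scan    : Scan free digits final
    value≡  : cgValue digits ≡ N
    -- needed to put a 2 on top, which leaves a remainder below F_{2k+1}
    closed  : N < fibOdd k → final ≡ free

open GreedyDigits

greedyDigits-∷ʳ : ∀ {k r d q N} (D : GreedyDigits k r) → Step (final D) d q →
  r + d * fibEven (suc k) ≡ N → (N < fibOdd (suc k) → q ≡ free) → GreedyDigits (suc k) N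
greedyDigits-∷ʳ {k} {r} {d} {N = N} D st r+dF≡N closedN = record
  { digits  = digits D ∷ʳ d
  ; length≡ = trans (length-++ (digits D)) (trans (+-comm _ 1) (cong suc (length≡ D)))
  ; scan    = scan-∷ʳ (scan D) st
  ; value≡  = begin
      cgValue (digits D ∷ʳ d)
        ≡⟨ cgValueFrom-∷ʳ 1 (digits D) d ⟩
      cgValue (digits D) + d * fibEven (suc (length (digits D)))
        ≡⟨ cong₂ (λ v l → v + d * fibEven (suc l)) (value≡ D) (length≡ D) ⟩
      r + d * fibEven (suc k)
        ≡⟨ r+dF≡N ⟩
      N ∎
  ; closed  = closedN
  }
  where open ≡-Reasoning

module _ {k : ℕ} where
  private
    F₁ F₂ : ℕ
    F₁ = fibOdd k
    F₂ = fibEven (suc k)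

  greedyDigits-top0 : ∀ {N} → GreedyDigits k N → GreedyDigits (suc k) N
  greedyDigits-top0 {N} D = greedyDigits-∷ʳ D read0 (+-identityʳ N) (λ _ → refl)

  greedyDigits-top1 : ∀ {r} → GreedyDigits k r → GreedyDigits (suc k) (F₂ + r)
  greedyDigits-top1 {r} D = greedyDigits-∷ʳ D read1
    (trans (cong (r +_) (*-identityˡ F₂)) (+-comm r F₂))
    (λ F₂+r<F₃ → closed D (+-cancelˡ-< F₂ r F₁ (subst (F₂ + r <_) (fibOdd-suc k) F₂+r<F₃)))

  greedyDigits-top2 : ∀ {s} → s < F₁ → GreedyDigits k s → GreedyDigits (suc k) (F₂ + (F₂ + s))
  greedyDigits-top2 {s} s<F₁ D = greedyDigits-∷ʳ D
    (subst (λ p → Step p 2 pending) (sym (closed D s<F₁)) read2)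
    (s+2F₂≡F₂+[F₂+s] s F₂)
    (λ N<F₃ → ⊥-elim (<⇒≱ N<F₃ F₃≤F₂+[F₂+s]))
    where
    open ≤-Reasoning
    s+2F₂≡F₂+[F₂+s] : ∀ s F₂ → s + 2 * F₂ ≡ F₂ + (F₂ + s)
    s+2F₂≡F₂+[F₂+s] = solve-∀
    F₃≤F₂+[F₂+s] : fibOdd (suc k) ≤ F₂ + (F₂ + s)
    F₃≤F₂+[F₂+s] = begin
      fibOdd (suc k) ≡⟨ fibOdd-suc k ⟩
      F₂ + F₁        ≤⟨ +-monoʳ-≤ F₂ (≤-trans (fibOdd≤fibEven-suc k) (m≤m+n F₂ s)) ⟩
      F₂ + (F₂ + s)  ∎

greedyDigits : ∀ k N → N < fibEven (suc k) → GreedyDigits k N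
greedyDigits zero    zero    _ =
  record { digits = [] ; length≡ = refl ; scan = [] ; value≡ = refl ; closed = λ _ → refl }
greedyDigits zero    (suc N) (s≤s ())
greedyDigits (suc k) N       N<F₄ with N <? fibEven (suc k)
... | yes N<F₂ = greedyDigits-top0 (greedyDigits k N N<F₂)
... | no N≮F₂ with m≤n⇒∃[o]m+o≡n (≮⇒≥ N≮F₂)
... | r , refl with r <? fibEven (suc k)
... | yes r<F₂ = greedyDigits-top1 (greedyDigits k r r<F₂)
... | no r≮F₂ with m≤n⇒∃[o]m+o≡n (≮⇒≥ r≮F₂)
... | s , refl = greedyDigits-top2 s<F₁ (greedyDigits k s (≤-trans s<F₁ (fibOdd≤fibEven-suc k)))
  where
  F₁ F₂ : ℕ
  F₁ = fibOdd k
  F₂ = fibEven (suc k)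
  F₄≡F₂+[F₂+F₁] : fibEven (suc (suc k)) ≡ F₂ + (F₂ + F₁)
  F₄≡F₂+[F₂+F₁] = trans (fibEven-suc (suc k)) (trans (cong (_+ F₂) (fibOdd-suc k)) (+-comm _ F₂))
  s<F₁ : s < F₁
  s<F₁ = +-cancelˡ-< F₂ s F₁
    (+-cancelˡ-< F₂ (F₂ + s) (F₂ + F₁) (subst (F₂ + (F₂ + s) <_) F₄≡F₂+[F₂+F₁] N<F₄))

cgRep-exists : ∀ N → ∃ (CGRep N)
cgRep-exists N = digits D , (scan-≤2 (scan D) , scan-zero-between-twos (scan D)) , value≡ D
  where D = greedyDigits N N (n<fibEven-suc N)

floorDivPhi-intro : ∀ n m → m * m + n * m ≤ n * n → n * n < suc m * suc m + n * suc m →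
  FloorDivPhi n m
floorDivPhi-intro n m lower upper =
  (begin
    (2 * m + n) * (2 * m + n)     ≡⟨ lower-square m n ⟩
    n * n + 4 * (m * m + n * m)   ≤⟨ +-monoʳ-≤ (n * n) (*-monoʳ-≤ 4 lower) ⟩
    n * n + 4 * (n * n)           ∎) ,
  (begin-strict
    n * n + 4 * (n * n)                        <⟨ +-monoʳ-< (n * n) (*-monoʳ-< 4 upper) ⟩
    n * n + 4 * (suc m * suc m + n * suc m)    ≡⟨ upper-square m n ⟨
    (2 * m + n + 2) * (2 * m + n + 2)          ∎)
  where
  open ≤-Reasoning
  lower-square : ∀ m n → (2 * m + n) * (2 * m + n) ≡ n * n + 4 * (m * m + n * m)
  lower-square = solve-∀
  upper-square : ∀ m n → (2 * m + n + 2) * (2 * m + n + 2) ≡ n * n + 4 * (suc m * suc m + n * suc m)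
  upper-square = solve-∀

record FloorInvariant (n m : ℕ) : Set where
  field
    m≤n    : m ≤ n
    n≤1+2m : n ≤ suc (2 * m)
    lower  : m * m + n * m ≤ n * n
    upper  : n * n < suc m * suc m + n * suc m

open FloorInvariant

-- e − n is the increase of (m + 1)² + n(m + 1) − n² in the step; it is
-- nonnegative only thanks to n ≤ 2m + 1 when c = 2.
upper-slack : ∀ c → c ≤ 2 → ∀ {n m} → n ≤ suc (2 * m) →
  let n′ = 2 * c + 2 * n + m ; m′ = c + n + m in
  ∃ λ e → n ≤ e ×
    suc m′ * suc m′ + n′ * suc m′ + (n * n + n) ≡ n′ * n′ + (suc m * suc m + n * suc m) + e
upper-slack 0 _ {n} {m} _ =
  4 * n + m , ≤-trans (m≤n*m n 4) (m≤m+n _ m) , identity n m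
  where
  identity : ∀ n m → let n′ = 2 * 0 + 2 * n + m ; m′ = 0 + n + m in
    suc m′ * suc m′ + n′ * suc m′ + (n * n + n) ≡
    n′ * n′ + (suc m * suc m + n * suc m) + (4 * n + m)
  identity = solve-∀
upper-slack 1 _ {n} {m} _ =
  2 * n + 2 * m + 3 , ≤-trans (m≤n*m n 2) (≤-trans (m≤m+n _ (2 * m)) (m≤m+n _ 3)) , identity n m
  where
  identity : ∀ n m → let n′ = 2 * 1 + 2 * n + m ; m′ = 1 + n + m in
    suc m′ * suc m′ + n′ * suc m′ + (n * n + n) ≡
    n′ * n′ + (suc m * suc m + n * suc m) + (2 * n + 2 * m + 3)
  identity = solve-∀
upper-slack 2 _ {n} {m} n≤1+2m =
  suc (2 * m) + (m + 3) , ≤-trans n≤1+2m (m≤m+n _ _) , identity n m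
  where
  identity : ∀ n m → let n′ = 2 * 2 + 2 * n + m ; m′ = 2 + n + m in
    suc m′ * suc m′ + n′ * suc m′ + (n * n + n) ≡
    n′ * n′ + (suc m * suc m + n * suc m) + (suc (2 * m) + (m + 3))
  identity = solve-∀
upper-slack (suc (suc (suc _))) (s≤s (s≤s ())) _

floorInvariant-step : ∀ {n m} c → c ≤ 2 → FloorInvariant n m →
  FloorInvariant (2 * c + 2 * n + m) (c + n + m)
floorInvariant-step {n} {m} c c≤2 I with upper-slack c c≤2 (n≤1+2m I)
... | e , n≤e , upper-identity = record
  { m≤n    = +-monoˡ-≤ m (+-mono-≤ (m≤n*m c 2) (m≤n*m n 2))
  ; n≤1+2m = ≤-trans (m≤m+n n′ (suc m)) (≤-reflexive (n′+1+m≡1+2m′ c n m))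
  ; lower  = +-cancelʳ-≤ (m * m + n * m + c * m) _ _ (begin
      m′ * m′ + n′ * m′ + (m * m + n * m + c * m)
        ≤⟨ +-monoʳ-≤ (m′ * m′ + n′ * m′) (+-mono-≤ (lower I) (*-monoʳ-≤ c (m≤n I))) ⟩
      m′ * m′ + n′ * m′ + (n * n + c * n)
        ≤⟨ m≤m+n _ (c * c + c * n) ⟩
      m′ * m′ + n′ * m′ + (n * n + c * n) + (c * c + c * n)
        ≡⟨ lower-identity c n m ⟩
      n′ * n′ + (m * m + n * m + c * m) ∎)
  ; upper  = +-cancelʳ-< (n * n + n) _ _ (begin-strict
      n′ * n′ + (n * n + n)                          ≡⟨ +-assoc (n′ * n′) (n * n) n ⟨
      n′ * n′ + n * n + n                            <⟨ +-monoˡ-< n (+-monoʳ-< (n′ * n′) (upper I)) ⟩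
      n′ * n′ + (suc m * suc m + n * suc m) + n      ≤⟨ +-monoʳ-≤ _ n≤e ⟩
      n′ * n′ + (suc m * suc m + n * suc m) + e      ≡⟨ upper-identity ⟨
      suc m′ * suc m′ + n′ * suc m′ + (n * n + n)    ∎)
  }
  where
  open ≤-Reasoning
  n′ m′ : ℕ
  n′ = 2 * c + 2 * n + m
  m′ = c + n + m
  n′+1+m≡1+2m′ : ∀ c n m → 2 * c + 2 * n + m + suc m ≡ suc (2 * (c + n + m))
  n′+1+m≡1+2m′ = solve-∀
  lower-identity : ∀ c n m → let n′ = 2 * c + 2 * n + m ; m′ = c + n + m in
    m′ * m′ + n′ * m′ + (n * n + c * n) + (c * c + c * n) ≡ n′ * n′ + (m * m + n * m + c * m)
  lower-identity = solve-∀

weighted : (ℕ → ℕ) → ℕ → List ℕ → ℕ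
weighted f j []       = 0
weighted f j (c ∷ cs) = c * f j + weighted f (suc j) cs

weighted-suc : ∀ {f g h : ℕ → ℕ} a b → (∀ j → f (suc j) ≡ a * g j + b * h j) →
  ∀ j cs → weighted f (suc j) cs ≡ a * weighted g j cs + b * weighted h j cs
weighted-suc a b f-suc j [] = sym (cong₂ _+_ (*-zeroʳ a) (*-zeroʳ b))
weighted-suc {f} {g} {h} a b f-suc j (c ∷ cs) = begin
  c * f (suc j) + weighted f (suc (suc j)) cs
    ≡⟨ cong₂ (λ x y → c * x + y) (f-suc j) (weighted-suc a b f-suc (suc j) cs) ⟩
  c * (a * g j + b * h j) + (a * weighted g (suc j) cs + b * weighted h (suc j) cs)
    ≡⟨ distribute a b c (g j) (h j) (weighted g (suc j) cs) (weighted h (suc j) cs) ⟩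
  a * (c * g j + weighted g (suc j) cs) + b * (c * h j + weighted h (suc j) cs)
    ∎
  where
  open ≡-Reasoning
  distribute : ∀ a b c x y X Y →
    c * (a * x + b * y) + (a * X + b * Y) ≡ a * (c * x + X) + b * (c * y + Y)
  distribute = solve-∀

weighted-fibEven-suc : ∀ j cs →
  weighted fibEven (suc j) cs ≡ weighted fibOdd j cs + weighted fibEven j cs
weighted-fibEven-suc j cs =
  trans (weighted-suc 1 1 fibEven-suc′ j cs) (1*x+1*y≡x+y (weighted fibOdd j cs) (weighted fibEven j cs))
  where
  1*x+1*y≡x+y : ∀ x y → 1 * x + 1 * y ≡ x + y
  1*x+1*y≡x+y x y = cong₂ _+_ (*-identityˡ x) (*-identityˡ y)
  fibEven-suc′ : ∀ i → fibEven (suc i) ≡ 1 * fibOdd i + 1 * fibEven i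
  fibEven-suc′ i = trans (fibEven-suc i) (sym (1*x+1*y≡x+y (fibOdd i) (fibEven i)))

weighted-fibOdd-suc : ∀ j cs →
  weighted fibOdd (suc j) cs ≡ 2 * weighted fibOdd j cs + weighted fibEven j cs
weighted-fibOdd-suc j cs =
  trans (weighted-suc 2 1 fibOdd-suc′ j cs) (cong (2 * weighted fibOdd j cs +_) (*-identityˡ _))
  where
  regroup : ∀ x y → x + y + x ≡ 2 * x + 1 * y
  regroup = solve-∀
  fibOdd-suc′ : ∀ i → fibOdd (suc i) ≡ 2 * fibOdd i + 1 * fibEven i
  fibOdd-suc′ i = begin
    fibOdd (suc i)                    ≡⟨ fibOdd-suc i ⟩
    fibEven (suc i) + fibOdd i        ≡⟨ cong (_+ fibOdd i) (fibEven-suc i) ⟩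
    fibOdd i + fibEven i + fibOdd i   ≡⟨ regroup (fibOdd i) (fibEven i) ⟩
    2 * fibOdd i + 1 * fibEven i      ∎
    where open ≡-Reasoning

cgValueFrom≡weighted : ∀ j cs → cgValueFrom j cs ≡ weighted fibEven j cs
cgValueFrom≡weighted j []       = refl
cgValueFrom≡weighted j (c ∷ cs) = cong (c * fibEven j +_) (cgValueFrom≡weighted (suc j) cs)

floorInvariant-tail : ∀ cs → All (_≤ 2) cs →
  FloorInvariant (weighted fibOdd 1 cs) (weighted fibEven 1 cs)
floorInvariant-tail []       []           =
  record { m≤n = z≤n ; n≤1+2m = z≤n ; lower = z≤n ; upper = s≤s z≤n }
floorInvariant-tail (c ∷ cs) (c≤2 ∷ cs≤2) =
  subst₂ FloorInvariant n-step m-step (floorInvariant-step c c≤2 (floorInvariant-tail cs cs≤2))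
  where
  open ≡-Reasoning
  n m : ℕ
  n = weighted fibOdd 1 cs
  m = weighted fibEven 1 cs
  n-step : 2 * c + 2 * n + m ≡ c * 2 + weighted fibOdd 2 cs
  n-step = begin
    2 * c + 2 * n + m      ≡⟨ +-assoc (2 * c) (2 * n) m ⟩
    2 * c + (2 * n + m)    ≡⟨ cong₂ _+_ (*-comm c 2) (weighted-fibOdd-suc 1 cs) ⟨
    c * 2 + weighted fibOdd 2 cs ∎
  m-step : c + n + m ≡ c * 1 + weighted fibEven 2 cs
  m-step = begin
    c + n + m              ≡⟨ +-assoc c n m ⟩
    c + (n + m)            ≡⟨ cong₂ _+_ (*-identityʳ c) (weighted-fibEven-suc 1 cs) ⟨
    c * 1 + weighted fibEven 2 cs ∎

digit₁≡0⇒floorDivPhi-split : ∀ c → All (_≤ 2) c → digit c 1 ≡ 0 →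
  ∃ λ n → ∃ λ m → m ≤ n × FloorDivPhi n m × cgValue c ≡ m + n
digit₁≡0⇒floorDivPhi-split []       _            _    =
  0 , 0 , z≤n , floorDivPhi-intro 0 0 z≤n (s≤s z≤n) , refl
digit₁≡0⇒floorDivPhi-split (_ ∷ cs) (_ ∷ cs≤2) refl =
  n , m , m≤n I , floorDivPhi-intro n m (lower I) (upper I) ,
  trans (cgValueFrom≡weighted 2 cs) (trans (weighted-fibEven-suc 1 cs) (+-comm n m))
  where
  n m : ℕ
  n = weighted fibOdd 1 cs
  m = weighted fibEven 1 cs
  I : FloorInvariant n m
  I = floorInvariant-tail cs cs≤2

theorem17 : ∀ (N : ℕ) → 1 ≤ N → ¬ B₂ N →
    ∃ λ n → ∃ λ m → 1 ≤ n × FloorDivPhi n m × N ≡ m + n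
theorem17 N 1≤N N∉B₂ with cgRep-exists N
... | c , rep@((c≤2 , _) , c↦N) with digit c 1 ≟ 0
...   | no  c₁≢0 = ⊥-elim (N∉B₂ (1≤N , c , rep , c₁≢0))
...   | yes c₁≡0 with digit₁≡0⇒floorDivPhi-split c c≤2 c₁≡0
...     | n , m , m≤n , floor , c↦m+n =
  n , m , positive m≤n (subst (1 ≤_) N≡m+n 1≤N) , floor , N≡m+n
  where
  N≡m+n : N ≡ m + n
  N≡m+n = trans (sym c↦N) c↦m+n
  positive : ∀ {m n} → m ≤ n → 1 ≤ m + n → 1 ≤ n
  positive {n = suc _} _ _ = s≤s z≤n
  positive {n = zero} z≤n ()
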